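{- Let $\{a_n\}_{n\geq 0}$ be the Narayana sequence, defined by $a_0=0$, $a_1=a_2=1$ and $a_n=a_{n-1}+a_{n-3}$ for $n\geq 3$. For every integer $n\geq 1$, \[\nu_3(a_n) = \begin{cases} 0, &\text{ if }n\equiv 1,2,3,4,6\pmod 8;\\ 1, &\text{ if }n\equiv 5,7,13,15\pmod {24};\\ 2, &\text{ if }n\equiv 8\pmod {24};\\ \nu_3(n+1)+1, &\text{ if }n\equiv 23\pmod {24};\\ \nu_3(n+3)+1, &\text{ if }n\equiv 21\pmod {24};\\ \nu_3(n)+2, &\text{ if }n\equiv 0\pmod {24};\\ \nu_3(n+8)+2, &\text{ if }n\equiv 16\pmod {24}. \end{cases}\]
   Context: For a prime $p$ and a nonzero integer $r$, $\nu_p(r)$ denotes the $p$-adic valuation of $r$, i.e. the exponent of the highest power of $p$ dividing $r$. -}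

module Defs where

open import Data.Nat using (ℕ; zero; suc; _+_; _^_)
open import Data.Nat.Divisibility using (_∣_)
open import Data.Product using (_×_)
open import Relation.Nullary using (¬_)

narayana : ℕ → ℕ
narayana 0 = 0
narayana 1 = 1
narayana 2 = 1
narayana (suc (suc (suc n))) = narayana (suc (suc n)) + narayana n

-- p-adic valuation as a relation: ν p r ≡ k  iff  p^k ∣ r and p^(k+1) ∤ r.
-- (Used only for nonzero r, where it determines k uniquely.)
IsValuation : ℕ → ℕ → ℕ → Set
IsValuation p r k = (p ^ k ∣ r) × ¬ (p ^ suc k ∣ r)

-- In ℤ[x]/(x³ − x² − 1) the x²-coordinate of x^(n+1) is a_n, and x²⁴ = 1 + 9β for an explicit β.
-- Cubing lifts this to x^(24·3ᵗ·u) = 1 + 9·3ᵗ·u·β + 81·3ᵗ·E, so a_(r+24K) ≡ a_r modulo 9 (modulo 27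
-- when r = 8), which settles the residues with ν₃(a_r) ≤ 2.  For n ≡ 23, 21, 0, 16 (mod 24) put
-- j = 0, 2, −1, 7, so that n + 1 + j = 24·3ᵗ·u with 3 ∤ u; then x^(n+1) = x^(−j)·x^(24·3ᵗ·u), the
-- x²-coordinate of x^(−j) vanishes, and a_n = 9·3ᵗ·(u·c + 9e) where c, the x²-coordinate of
-- x^(−j)·β, has ν₃(c) ≤ 1.  Hence ν₃(a_n) = t + 2 + ν₃(c) while ν₃(n + 1 + j) = t + 1.
module Submission where

open import Defs
open import Data.Nat
  using (ℕ; zero; suc; _+_; _*_; _∸_; _^_; _%_; _/_; _<_; _≤_; _≥_; z≤n; s≤s; NonZero; nonTrivial⇒n>1)
open import Data.Nat.Properties
  using (_≟_; +-comm; +-suc; +-identityʳ; *-comm; *-identityˡ; ^-distribˡ-+-*; m^n≢0; m<m*n; m*n≢0⇒m≢0; allUpTo?)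
open import Data.Nat.DivMod using (m≡m%n+[m/n]*n; m%n<n; m∣n⇒o%n%m≡o%m)
open import Data.Nat.Divisibility using (_∣_; divides; _∣?_; *-cancelˡ-∣; *-monoˡ-∣; ∣1⇒≡1)
open import Data.Nat.Primality using (Prime; prime?; euclidsLemma; prime⇒nonZero; prime⇒nonTrivial)
open import Data.Nat.Induction using (<-wellFounded)
import Data.Nat.Tactic.RingSolver as ℕ-Solver
open import Data.Integer as ℤ using (ℤ; +_; ∣_∣)
import Data.Integer.Properties as ℤ
open import Data.Integer.Divisibility.Signed using (∣ᵤ⇒∣; ∣⇒∣ᵤ; ∣m+n∣n⇒∣m; ∣m⇒∣m*n; ∣-refl)
open import Data.Integer.Solver using (module +-*-Solver)
import Data.Integer.Tactic.RingSolver as ℤ-Solver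
open import Data.Product using (_,_; _×_; ∃; ∃₂; map₂)
open import Data.Sum using (_⊎_; [_,_]′)
open import Function using (id)
open import Induction.WellFounded using (Acc; acc)
open import Relation.Binary.PropositionalEquality
  using (_≡_; refl; sym; trans; cong; cong₂; subst; module ≡-Reasoning)
open import Relation.Nullary using (¬_; Dec; ¬?; yes; no)
open import Relation.Nullary.Decidable using (from-yes; from-no; _×-dec_; _⊎-dec_; _→-dec_)

open +-*-Solver using (solve; _:=_; _:+_; _:*_; con; Polynomial)
open ≡-Reasoning

isValuation? : ∀ p r k → Dec (IsValuation p r k)
isValuation? p r k = (p ^ k ∣? r) ×-dec ¬? (p ^ suc k ∣? r)

isValuation-^* : ∀ {p} .{{_ : NonZero p}} s {w} → ¬ p ∣ w → IsValuation p (p ^ s * w) s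
isValuation-^* {p} s {w} p∤w =
  divides w (*-comm (p ^ s) w) ,
  λ p^[1+s]∣ → p∤w (*-cancelˡ-∣ (p ^ s) {{m^n≢0 p s}} (subst (_∣ p ^ s * w) (*-comm p (p ^ s)) p^[1+s]∣))

module _ {p : ℕ} (p-prime : Prime p) where

  private instance
    p≢0 : NonZero p
    p≢0 = prime⇒nonZero p-prime

  p∤u*c+p*d : ∀ {u c} d → ¬ p ∣ u → ¬ p ∣ ∣ c ∣ → ¬ p ∣ ∣ + u ℤ.* c ℤ.+ + p ℤ.* d ∣
  p∤u*c+p*d {u} {c} d p∤u p∤c p∣ = [ p∤u , p∤c ]′ (euclidsLemma u ∣ c ∣ p-prime p∣u*c)
    where
    p∣u*c : p ∣ u * ∣ c ∣
    p∣u*c = subst (p ∣_) (ℤ.abs-* (+ u) c)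
      (∣⇒∣ᵤ (∣m+n∣n⇒∣m {+ p} {+ u ℤ.* c} (∣ᵤ⇒∣ p∣) (∣m⇒∣m*n d (∣-refl {+ p}))))

  isValuation-p^s*[u*c+p*d] : ∀ {m} s {u} c d → + m ≡ + (p ^ s) ℤ.* (+ u ℤ.* c ℤ.+ + p ℤ.* d) →
                               ¬ p ∣ u → ¬ p ∣ ∣ c ∣ → IsValuation p m s
  isValuation-p^s*[u*c+p*d] {m} s {u} c d m≡ p∤u p∤c =
    subst (λ n → IsValuation p n s) (sym m≡p^s*∣w∣) (isValuation-^* s (p∤u*c+p*d d p∤u p∤c))
    where
    m≡p^s*∣w∣ : m ≡ p ^ s * ∣ + u ℤ.* c ℤ.+ + p ℤ.* d ∣
    m≡p^s*∣w∣ = trans (cong ∣_∣ m≡) (ℤ.abs-* (+ (p ^ s)) _)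

  isValuation-+-p^[1+s]* : ∀ {a b} s d → IsValuation p b s → + a ≡ + b ℤ.+ + (p ^ suc s) ℤ.* d →
                           IsValuation p a s
  isValuation-+-p^[1+s]* s d (divides c refl , p^[1+s]∤b) a≡ =
    isValuation-p^s*[u*c+p*d] s (+ c) d (trans a≡ b+p^[1+s]*d≡) p∤1 p∤c
    where
    p∤1 : ¬ p ∣ 1
    p∤1 p∣1 with ∣1⇒≡1 p∣1 | prime⇒nonTrivial p-prime
    ... | refl | ()
    p∤c : ¬ p ∣ c
    p∤c p∣c = p^[1+s]∤b (*-monoˡ-∣ (p ^ s) p∣c)
    factor : ∀ c q p d → c ℤ.* q ℤ.+ p ℤ.* q ℤ.* d ≡ q ℤ.* (+ 1 ℤ.* c ℤ.+ p ℤ.* d)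
    factor = ℤ-Solver.solve-∀
    b+p^[1+s]*d≡ : + (c * p ^ s) ℤ.+ + (p ^ suc s) ℤ.* d ≡ + (p ^ s) ℤ.* (+ 1 ℤ.* + c ℤ.+ + p ℤ.* d)
    b+p^[1+s]*d≡ =
      trans (cong₂ (λ y z → y ℤ.+ z ℤ.* d) (ℤ.pos-* c (p ^ s)) (ℤ.pos-* p (p ^ s))) (factor (+ c) (+ (p ^ s)) (+ p) d)

  p-adic-decomposition : ∀ M .{{_ : NonZero M}} → ∃₂ λ t u → M ≡ p ^ t * u × ¬ p ∣ u
  p-adic-decomposition M = go M (<-wellFounded M)
    where
    go : ∀ M .{{_ : NonZero M}} → Acc _<_ M → ∃₂ λ t u → M ≡ p ^ t * u × ¬ p ∣ u
    go M (acc smaller) with p ∣? M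
    ... | no p∤M = 0 , M , sym (*-identityˡ M) , p∤M
    ... | yes (divides q refl) = divide-out (go q {{q≢0}} (smaller (m<m*n q p {{q≢0}} p>1)))
      where
      q≢0 : NonZero q
      q≢0 = m*n≢0⇒m≢0 q
      p>1 : 1 < p
      p>1 = nonTrivial⇒n>1 p {{prime⇒nonTrivial p-prime}}
      reassociate : ∀ y u p → y * u * p ≡ p * y * u
      reassociate = ℕ-Solver.solve-∀
      divide-out : (∃₂ λ t u → q ≡ p ^ t * u × ¬ p ∣ u) → ∃₂ λ t u → q * p ≡ p ^ t * u × ¬ p ∣ u
      divide-out (t , u , refl , p∤u) = suc t , u , reassociate (p ^ t) u p , p∤u

3-prime : Prime 3
3-prime = from-yes (prime? 3)

-- The ring ℤ[x]/(x³ − x² − 1)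

-- a + b x + c x² is ⟨ a , b , c ⟩.  The operations are written over an arbitrary carrier so that,
-- instantiated at solver polynomials, each ring identity below is checked componentwise.
record Cubic (A : Set) : Set where
  constructor ⟨_,_,_⟩
  field
    c₀ c₁ c₂ : A

open Cubic

module Arithmetic {A : Set} (_⊞_ _⊠_ : A → A → A) (κ : ℤ → A) where

  infixl 6 _⊕_
  infixl 7 _⊗_ _·_

  _⊕_ : Cubic A → Cubic A → Cubic A
  ⟨ a₀ , a₁ , a₂ ⟩ ⊕ ⟨ b₀ , b₁ , b₂ ⟩ = ⟨ a₀ ⊞ b₀ , a₁ ⊞ b₁ , a₂ ⊞ b₂ ⟩

  _·_ : A → Cubic A → Cubic A
  k · ⟨ a₀ , a₁ , a₂ ⟩ = ⟨ k ⊠ a₀ , k ⊠ a₁ , k ⊠ a₂ ⟩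

  -- The coefficients d₀ … d₄ of the product polynomial, reduced by x³ = 1 + x² and x⁴ = 1 + x + x².
  _⊗_ : Cubic A → Cubic A → Cubic A
  ⟨ a₀ , a₁ , a₂ ⟩ ⊗ ⟨ b₀ , b₁ , b₂ ⟩ = ⟨ d₀ ⊞ (d₃ ⊞ d₄) , d₁ ⊞ d₄ , d₂ ⊞ (d₃ ⊞ d₄) ⟩
    where
    d₀ = a₀ ⊠ b₀
    d₁ = (a₀ ⊠ b₁) ⊞ (a₁ ⊠ b₀)
    d₂ = (a₀ ⊠ b₂) ⊞ ((a₁ ⊠ b₁) ⊞ (a₂ ⊠ b₀))
    d₃ = (a₁ ⊠ b₂) ⊞ (a₂ ⊠ b₁)
    d₄ = a₂ ⊠ b₂

  𝟙 x β : Cubic A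
  𝟙 = ⟨ κ (+ 1) , κ (+ 0) , κ (+ 0) ⟩
  x = ⟨ κ (+ 0) , κ (+ 1) , κ (+ 0) ⟩
  β = ⟨ κ (+ 208) , κ (+ 142) , κ (+ 305) ⟩

  nearOne : A → A → Cubic A → Cubic A
  nearOne p u E = 𝟙 ⊕ (κ (+ 9) ⊠ (p ⊠ u)) · β ⊕ (κ (+ 81) ⊠ p) · E

  -- nearOne p u E = 1 + 9 p Z with Z = u β + 9 E, and (1 + 9 p Z)³ = 1 + 27 p Z + 243 p² Z² + 729 p³ Z³.
  cubeError : A → A → Cubic A → Cubic A
  cubeError p u E = E ⊕ p · (Z ⊗ Z) ⊕ (κ (+ 3) ⊠ (p ⊠ p)) · (Z ⊗ (Z ⊗ Z))
    where
    Z = u · β ⊕ κ (+ 9) · E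

  succError : A → Cubic A → Cubic A
  succError u E = E ⊕ u · (β ⊗ β) ⊕ κ (+ 9) · (β ⊗ E)

open Arithmetic ℤ._+_ ℤ._*_ id

private
  module P {n} = Arithmetic {Polynomial n} _:+_ _:*_ con

cubic-≡ : ∀ {a₀ a₁ a₂ b₀ b₁ b₂ : ℤ} → a₀ ≡ b₀ → a₁ ≡ b₁ → a₂ ≡ b₂ → ⟨ a₀ , a₁ , a₂ ⟩ ≡ ⟨ b₀ , b₁ , b₂ ⟩
cubic-≡ refl refl refl = refl

⊗-assoc : ∀ u v w → (u ⊗ v) ⊗ w ≡ u ⊗ (v ⊗ w)
⊗-assoc ⟨ a , b , c ⟩ ⟨ d , e , f ⟩ ⟨ g , h , i ⟩ = cubic-≡
  (solve 9 (λ a b c d e f g h i → c₀ (L a b c d e f g h i) := c₀ (R a b c d e f g h i)) refl a b c d e f g h i)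
  (solve 9 (λ a b c d e f g h i → c₁ (L a b c d e f g h i) := c₁ (R a b c d e f g h i)) refl a b c d e f g h i)
  (solve 9 (λ a b c d e f g h i → c₂ (L a b c d e f g h i) := c₂ (R a b c d e f g h i)) refl a b c d e f g h i)
  where
  L R : ∀ {n} (a b c d e f g h i : Polynomial n) → Cubic (Polynomial n)
  L a b c d e f g h i = (⟨ a , b , c ⟩ P.⊗ ⟨ d , e , f ⟩) P.⊗ ⟨ g , h , i ⟩
  R a b c d e f g h i = ⟨ a , b , c ⟩ P.⊗ (⟨ d , e , f ⟩ P.⊗ ⟨ g , h , i ⟩)

⊗-identityˡ : ∀ u → 𝟙 ⊗ u ≡ u
⊗-identityˡ ⟨ a , b , c ⟩ = cubic-≡
  (solve 3 (λ a b c → c₀ (P.𝟙 P.⊗ ⟨ a , b , c ⟩) := a) refl a b c)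
  (solve 3 (λ a b c → c₁ (P.𝟙 P.⊗ ⟨ a , b , c ⟩) := b) refl a b c)
  (solve 3 (λ a b c → c₂ (P.𝟙 P.⊗ ⟨ a , b , c ⟩) := c) refl a b c)

x⊗ : ∀ a b c → x ⊗ ⟨ a , b , c ⟩ ≡ ⟨ c , a , b ℤ.+ c ⟩
x⊗ a b c = cubic-≡
  (solve 3 (λ a b c → c₀ (P.x P.⊗ ⟨ a , b , c ⟩) := c) refl a b c)
  (solve 3 (λ a b c → c₁ (P.x P.⊗ ⟨ a , b , c ⟩) := a) refl a b c)
  (solve 3 (λ a b c → c₂ (P.x P.⊗ ⟨ a , b , c ⟩) := b :+ c) refl a b c)

nearOne-cube : ∀ p u E →
  nearOne p u E ⊗ (nearOne p u E ⊗ nearOne p u E) ≡ nearOne (+ 3 ℤ.* p) u (cubeError p u E)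
nearOne-cube p u ⟨ a , b , c ⟩ = cubic-≡
  (solve 5 (λ p u a b c → c₀ (L p u a b c) := c₀ (R p u a b c)) refl p u a b c)
  (solve 5 (λ p u a b c → c₁ (L p u a b c) := c₁ (R p u a b c)) refl p u a b c)
  (solve 5 (λ p u a b c → c₂ (L p u a b c) := c₂ (R p u a b c)) refl p u a b c)
  where
  L R : ∀ {n} (p u a b c : Polynomial n) → Cubic (Polynomial n)
  L p u a b c = let y = P.nearOne p u ⟨ a , b , c ⟩ in y P.⊗ (y P.⊗ y)
  R p u a b c = P.nearOne (con (+ 3) :* p) u (P.cubeError p u ⟨ a , b , c ⟩)

[1+9β]⊗nearOne : ∀ u E → (𝟙 ⊕ + 9 · β) ⊗ nearOne (+ 1) u E ≡ nearOne (+ 1) (+ 1 ℤ.+ u) (succError u E)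
[1+9β]⊗nearOne u ⟨ a , b , c ⟩ = cubic-≡
  (solve 4 (λ u a b c → c₀ (L u a b c) := c₀ (R u a b c)) refl u a b c)
  (solve 4 (λ u a b c → c₁ (L u a b c) := c₁ (R u a b c)) refl u a b c)
  (solve 4 (λ u a b c → c₂ (L u a b c) := c₂ (R u a b c)) refl u a b c)
  where
  L R : ∀ {n} (u a b c : Polynomial n) → Cubic (Polynomial n)
  L u a b c = (P.𝟙 P.⊕ con (+ 9) P.· P.β) P.⊗ P.nearOne (con (+ 1)) u ⟨ a , b , c ⟩
  R u a b c = P.nearOne (con (+ 1)) (con (+ 1) :+ u) (P.succError u ⟨ a , b , c ⟩)

c₂-⊗-nearOne : ∀ V p u E →
  c₂ (V ⊗ nearOne p u E) ≡ c₂ V ℤ.+ p ℤ.* (+ 9 ℤ.* (u ℤ.* c₂ (V ⊗ β) ℤ.+ + 9 ℤ.* c₂ (V ⊗ E)))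
c₂-⊗-nearOne ⟨ v₀ , v₁ , v₂ ⟩ p u ⟨ a , b , c ⟩ =
  solve 8 (λ v₀ v₁ v₂ p u a b c →
             let V = ⟨ v₀ , v₁ , v₂ ⟩ in
             c₂ (V P.⊗ P.nearOne p u ⟨ a , b , c ⟩)
               := v₂ :+ p :* (con (+ 9) :* (u :* c₂ (V P.⊗ P.β) :+ con (+ 9) :* c₂ (V P.⊗ ⟨ a , b , c ⟩))))
          refl v₀ v₁ v₂ p u a b c

infix 8 x^_

-- Opaque: unfolding x^ n during conversion checking duplicates subterms and takes time exponential in n.
opaque
  x^_ : ℕ → Cubic ℤ
  x^ zero = 𝟙
  x^ suc n = x ⊗ x^ n

  x^-zero : x^ zero ≡ 𝟙
  x^-zero = refl

  x^-suc : ∀ n → x^ suc n ≡ x ⊗ x^ n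
  x^-suc n = refl

  x^1 : x^ 1 ≡ ⟨ + 0 , + 1 , + 0 ⟩
  x^1 = refl

  x^2 : x^ 2 ≡ ⟨ + 0 , + 0 , + 1 ⟩
  x^2 = refl

  x^3 : x^ 3 ≡ ⟨ + 1 , + 0 , + 1 ⟩
  x^3 = refl

x^-+ : ∀ m n → x^ (m + n) ≡ x^ m ⊗ x^ n
x^-+ zero n = begin
  x^ n         ≡⟨ ⊗-identityˡ (x^ n) ⟨
  𝟙 ⊗ x^ n     ≡⟨ cong (_⊗ x^ n) x^-zero ⟨
  x^ 0 ⊗ x^ n  ∎
x^-+ (suc m) n = begin
  x^ suc (m + n)      ≡⟨ x^-suc (m + n) ⟩
  x ⊗ x^ (m + n)      ≡⟨ cong (x ⊗_) (x^-+ m n) ⟩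
  x ⊗ (x^ m ⊗ x^ n)   ≡⟨ ⊗-assoc x (x^ m) (x^ n) ⟨
  (x ⊗ x^ m) ⊗ x^ n   ≡⟨ cong (_⊗ x^ n) (x^-suc m) ⟨
  x^ suc m ⊗ x^ n     ∎

x^-3* : ∀ m → x^ (3 * m) ≡ x^ m ⊗ (x^ m ⊗ x^ m)
x^-3* m = begin
  x^ (m + (m + (m + 0)))  ≡⟨ cong (λ k → x^ (m + (m + k))) (+-identityʳ m) ⟩
  x^ (m + (m + m))        ≡⟨ x^-+ m (m + m) ⟩
  x^ m ⊗ x^ (m + m)       ≡⟨ cong (x^ m ⊗_) (x^-+ m m) ⟩
  x^ m ⊗ (x^ m ⊗ x^ m)    ∎

x^-shift : ∀ W j n → W ⊗ x^ j ≡ 𝟙 → x^ suc n ≡ W ⊗ x^ (n + suc j)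
x^-shift W j n W⊗x^j≡𝟙 = begin
  x^ suc n               ≡⟨ ⊗-identityˡ (x^ suc n) ⟨
  𝟙 ⊗ x^ suc n           ≡⟨ cong (_⊗ x^ suc n) W⊗x^j≡𝟙 ⟨
  (W ⊗ x^ j) ⊗ x^ suc n  ≡⟨ ⊗-assoc W (x^ j) (x^ suc n) ⟩
  W ⊗ (x^ j ⊗ x^ suc n)  ≡⟨ cong (W ⊗_) (x^-+ j (suc n)) ⟨
  W ⊗ x^ (j + suc n)     ≡⟨ cong (λ k → W ⊗ x^ k) (trans (+-comm j (suc n)) (sym (+-suc n j))) ⟩
  W ⊗ x^ (n + suc j)     ∎

x^[3+n] : ∀ n → x^ (3 + n) ≡ ⟨ + narayana (1 + n) , + narayana n , + narayana (2 + n) ⟩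
x^[3+n] zero = x^3
x^[3+n] (suc n) = begin
  x^ (4 + n)                               ≡⟨ x^-suc (3 + n) ⟩
  x ⊗ x^ (3 + n)                           ≡⟨ cong (x ⊗_) (x^[3+n] n) ⟩
  x ⊗ ⟨ + a₁ , + a₀ , + a₂ ⟩               ≡⟨ x⊗ (+ a₁) (+ a₀) (+ a₂) ⟩
  ⟨ + a₂ , + a₁ , + (a₀ + a₂) ⟩            ≡⟨ cong (λ k → ⟨ + a₂ , + a₁ , + k ⟩) (+-comm a₀ a₂) ⟩
  ⟨ + a₂ , + a₁ , + narayana (3 + n) ⟩     ∎
  where
  a₀ = narayana n
  a₁ = narayana (1 + n)
  a₂ = narayana (2 + n)

c₂-x^ : ∀ n → c₂ (x^ suc n) ≡ + narayana n
c₂-x^ 0 = cong c₂ x^1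
c₂-x^ 1 = cong c₂ x^2
c₂-x^ (suc (suc n)) = cong c₂ (x^[3+n] n)

x^24 : x^ 24 ≡ 𝟙 ⊕ + 9 · β
x^24 = x^[3+n] 21

x^[u*24] : ∀ u → ∃ λ E → x^ (u * 24) ≡ nearOne (+ 1) (+ u) E
x^[u*24] zero = ⟨ + 0 , + 0 , + 0 ⟩ , x^-zero
x^[u*24] (suc u) with x^[u*24] u
... | E , x^[u*24]≡ = succError (+ u) E , (begin
  x^ (24 + u * 24)                         ≡⟨ x^-+ 24 (u * 24) ⟩
  x^ 24 ⊗ x^ (u * 24)                      ≡⟨ cong (x^ 24 ⊗_) x^[u*24]≡ ⟩
  x^ 24 ⊗ nearOne (+ 1) (+ u) E            ≡⟨ cong (_⊗ nearOne (+ 1) (+ u) E) x^24 ⟩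
  (𝟙 ⊕ + 9 · β) ⊗ nearOne (+ 1) (+ u) E    ≡⟨ [1+9β]⊗nearOne (+ u) E ⟩
  nearOne (+ 1) (+ suc u) (succError (+ u) E) ∎)

x^[3ᵗ*u*24] : ∀ t u → ∃ λ E → x^ (3 ^ t * u * 24) ≡ nearOne (+ (3 ^ t)) (+ u) E
x^[3ᵗ*u*24] zero u =
  subst (λ k → ∃ λ E → x^ (k * 24) ≡ nearOne (+ 1) (+ u) E) (sym (*-identityˡ u)) (x^[u*24] u)
x^[3ᵗ*u*24] (suc t) u with x^[3ᵗ*u*24] t u
... | E , x^m≡ = cubeError p (+ u) E , (begin
  x^ (3 ^ suc t * u * 24)                               ≡⟨ cong x^_ (regroup (3 ^ t) u) ⟩
  x^ (3 * m)                                            ≡⟨ x^-3* m ⟩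
  x^ m ⊗ (x^ m ⊗ x^ m)                                  ≡⟨ cong (λ y → y ⊗ (y ⊗ y)) x^m≡ ⟩
  y ⊗ (y ⊗ y)                                           ≡⟨ nearOne-cube p (+ u) E ⟩
  nearOne (+ 3 ℤ.* p) (+ u) (cubeError p (+ u) E)       ≡⟨ cong (λ q → nearOne q (+ u) (cubeError p (+ u) E)) (ℤ.pos-* 3 (3 ^ t)) ⟨
  nearOne (+ (3 ^ suc t)) (+ u) (cubeError p (+ u) E)   ∎)
  where
  m = 3 ^ t * u * 24
  p = + (3 ^ t)
  y = nearOne p (+ u) E
  regroup : ∀ y u → 3 * y * u * 24 ≡ 3 * (y * u * 24)
  regroup = ℕ-Solver.solve-∀

c₂-⊗-x^[3ᵗ*u*24] : ∀ V t u → ∃ λ e →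
  c₂ (V ⊗ x^ (3 ^ t * u * 24)) ≡ c₂ V ℤ.+ + (3 ^ t) ℤ.* (+ 9 ℤ.* (+ u ℤ.* c₂ (V ⊗ β) ℤ.+ + 9 ℤ.* e))
c₂-⊗-x^[3ᵗ*u*24] V t u with x^[3ᵗ*u*24] t u
... | E , x^≡ = c₂ (V ⊗ E) , trans (cong (λ y → c₂ (V ⊗ y)) x^≡) (c₂-⊗-nearOne V (+ (3 ^ t)) (+ u) E)

-- Narayana numbers in residue classes mod 24

narayana[r+K*24] : ∀ r K → ∃ λ e →
  + narayana (r + K * 24) ≡ + narayana r ℤ.+ + 9 ℤ.* (+ K ℤ.* c₂ (x^ suc r ⊗ β) ℤ.+ + 9 ℤ.* e)
narayana[r+K*24] r K = map₂ rearrange (c₂-⊗-x^[3ᵗ*u*24] (x^ suc r) 0 K)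
  where
  rearrange : ∀ {Δ} → c₂ (x^ suc r ⊗ x^ (1 * K * 24)) ≡ c₂ (x^ suc r) ℤ.+ + 1 ℤ.* Δ →
              + narayana (r + K * 24) ≡ + narayana r ℤ.+ Δ
  rearrange {Δ} c₂≡ = begin
    + narayana (r + K * 24)           ≡⟨ c₂-x^ (r + K * 24) ⟨
    c₂ (x^ (suc r + K * 24))          ≡⟨ cong c₂ (x^-+ (suc r) (K * 24)) ⟩
    c₂ (x^ suc r ⊗ x^ (K * 24))       ≡⟨ cong (λ k → c₂ (x^ suc r ⊗ x^ (k * 24))) (*-identityˡ K) ⟨
    c₂ (x^ suc r ⊗ x^ (1 * K * 24))   ≡⟨ c₂≡ ⟩
    c₂ (x^ suc r) ℤ.+ + 1 ℤ.* Δ       ≡⟨ cong₂ ℤ._+_ (c₂-x^ r) (ℤ.*-identityˡ Δ) ⟩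
    + narayana r ℤ.+ Δ                ∎

9*≡3^[1+s]*3^[1∸s]* : ∀ {s} → s ≤ 1 → ∀ D → + 9 ℤ.* D ≡ + (3 ^ suc s) ℤ.* (+ (3 ^ (1 ∸ s)) ℤ.* D)
9*≡3^[1+s]*3^[1∸s]* z≤n D = ℤ.*-assoc (+ 3) (+ 3) D
9*≡3^[1+s]*3^[1∸s]* (s≤s z≤n) D = cong (ℤ._*_ (+ 9)) (sym (ℤ.*-identityˡ D))

isValuation-narayana-periodic : ∀ r {s} K → s ≤ 1 → IsValuation 3 (narayana r) s →
                                IsValuation 3 (narayana (r + K * 24)) s
isValuation-narayana-periodic r {s} K s≤1 ν =
  let e , a≡ = narayana[r+K*24] r K
      D = + K ℤ.* c₂ (x^ suc r ⊗ β) ℤ.+ + 9 ℤ.* e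
  in isValuation-+-p^[1+s]* 3-prime s (+ (3 ^ (1 ∸ s)) ℤ.* D) ν
       (trans a≡ (cong (ℤ._+_ (+ narayana r)) (9*≡3^[1+s]*3^[1∸s]* s≤1 D)))

isValuation-narayana[8+K*24] : ∀ K → IsValuation 3 (narayana (8 + K * 24)) 2
isValuation-narayana[8+K*24] K =
  let e , a≡ = narayana[r+K*24] 8 K
  in isValuation-+-p^[1+s]* 3-prime 2 (+ 3171 ℤ.* + K ℤ.+ + 3 ℤ.* e) (from-yes (isValuation? 3 (narayana 8) 2))
       (trans a≡ (cong (ℤ._+_ (+ 9)) (trans (cong (λ q → + 9 ℤ.* (+ K ℤ.* q ℤ.+ + 9 ℤ.* e)) c₂[x⁹⊗β])
                                             (regroup (+ K) e))))
  where
  c₂[x⁹⊗β] : c₂ (x^ 9 ⊗ β) ≡ + 9513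
  c₂[x⁹⊗β] = cong (λ v → c₂ (v ⊗ β)) (x^[3+n] 6)
  regroup : ∀ K e → + 9 ℤ.* (K ℤ.* + 9513 ℤ.+ + 9 ℤ.* e) ≡ + 27 ℤ.* (+ 3171 ℤ.* K ℤ.+ + 3 ℤ.* e)
  regroup = ℤ-Solver.solve-∀

isValuation-3ᵗ*u*24 : ∀ t {u} → ¬ 3 ∣ u → IsValuation 3 (3 ^ t * u * 24) (suc t)
isValuation-3ᵗ*u*24 t {u} 3∤u =
  subst (λ m → IsValuation 3 m (suc t)) (sym (regroup (3 ^ t) u)) (isValuation-^* (suc t) 3∤u*8)
  where
  regroup : ∀ y u → y * u * 24 ≡ 3 * y * (u * 8)
  regroup = ℕ-Solver.solve-∀
  3∤u*8 : ¬ 3 ∣ u * 8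
  3∤u*8 3∣u*8 = [ 3∤u , from-no (3 ∣? 8) ]′ (euclidsLemma u 8 3-prime 3∣u*8)

+3^[1+t+k] : ∀ t k → + (3 ^ (suc t + k)) ≡ + (3 ^ suc k) ℤ.* + (3 ^ t)
+3^[1+t+k] t k = begin
  + (3 ^ suc (t + k))          ≡⟨ cong (λ j → + (3 ^ suc j)) (+-comm t k) ⟩
  + (3 ^ (suc k + t))          ≡⟨ cong +_ (^-distribˡ-+-* 3 (suc k) t) ⟩
  + (3 ^ suc k * 3 ^ t)        ≡⟨ ℤ.pos-* (3 ^ suc k) (3 ^ t) ⟩
  + (3 ^ suc k) ℤ.* + (3 ^ t)  ∎

isValuation-3ᵗ*9*[u*3ˢc+9e] : ∀ {a} t {u} s c e → s ≤ 1 →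
  + a ≡ + (3 ^ t) ℤ.* (+ 9 ℤ.* (+ u ℤ.* (+ (3 ^ s) ℤ.* c) ℤ.+ + 9 ℤ.* e)) → ¬ 3 ∣ u → ¬ 3 ∣ ∣ c ∣ →
  IsValuation 3 a (suc t + (1 + s))
isValuation-3ᵗ*9*[u*3ˢc+9e] t {u} s c e s≤1 a≡ =
  isValuation-p^s*[u*c+p*d] 3-prime (suc t + (1 + s)) c (+ (3 ^ (1 ∸ s)) ℤ.* e) (trans a≡ (rescale s≤1))
  where
  rescale : s ≤ 1 → + (3 ^ t) ℤ.* (+ 9 ℤ.* (+ u ℤ.* (+ (3 ^ s) ℤ.* c) ℤ.+ + 9 ℤ.* e)) ≡
                    + (3 ^ (suc t + (1 + s))) ℤ.* (+ u ℤ.* c ℤ.+ + 3 ℤ.* (+ (3 ^ (1 ∸ s)) ℤ.* e))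
  rescale z≤n = trans (regroup (+ (3 ^ t)) (+ u) c e) (cong (ℤ._* _) (sym (+3^[1+t+k] t 1)))
    where
    regroup : ∀ P u c e → P ℤ.* (+ 9 ℤ.* (u ℤ.* (+ 1 ℤ.* c) ℤ.+ + 9 ℤ.* e)) ≡
                          + 9 ℤ.* P ℤ.* (u ℤ.* c ℤ.+ + 3 ℤ.* (+ 3 ℤ.* e))
    regroup = ℤ-Solver.solve-∀
  rescale (s≤s z≤n) = trans (regroup (+ (3 ^ t)) (+ u) c e) (cong (ℤ._* _) (sym (+3^[1+t+k] t 2)))
    where
    regroup : ∀ P u c e → P ℤ.* (+ 9 ℤ.* (u ℤ.* (+ 3 ℤ.* c) ℤ.+ + 9 ℤ.* e)) ≡
                          + 27 ℤ.* P ℤ.* (u ℤ.* c ℤ.+ + 3 ℤ.* (+ 1 ℤ.* e))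
    regroup = ℤ-Solver.solve-∀

isValuation-narayana-near-24M : ∀ n {m} M W {s} c → m ≡ suc M * 24 → x^ suc n ≡ W ⊗ x^ m →
  c₂ W ≡ + 0 → c₂ (W ⊗ β) ≡ + (3 ^ s) ℤ.* c → s ≤ 1 → ¬ 3 ∣ ∣ c ∣ →
  ∃ λ k → IsValuation 3 m k × IsValuation 3 (narayana n) (k + (1 + s))
isValuation-narayana-near-24M n {m} M W {s} c m≡ x^[1+n]≡ c₂W≡0 c₂[W⊗β]≡ s≤1 3∤c =
  from-decomposition (p-adic-decomposition 3-prime (suc M))
  where
  from-decomposition : (∃₂ λ t u → suc M ≡ 3 ^ t * u × ¬ 3 ∣ u) →
                       ∃ λ k → IsValuation 3 m k × IsValuation 3 (narayana n) (k + (1 + s))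
  from-decomposition (t , u , 1+M≡ , 3∤u) =
    suc t ,
    subst (λ m → IsValuation 3 m (suc t)) (sym m≡3ᵗ*u*24) (isValuation-3ᵗ*u*24 t 3∤u) ,
    (let e , c₂≡ = c₂-⊗-x^[3ᵗ*u*24] W t u
     in isValuation-3ᵗ*9*[u*3ˢc+9e] t s c e s≤1 (narayana≡ c₂≡) 3∤u 3∤c)
    where
    m≡3ᵗ*u*24 : m ≡ 3 ^ t * u * 24
    m≡3ᵗ*u*24 = trans m≡ (cong (_* 24) 1+M≡)
    narayana≡ : ∀ {e} →
      c₂ (W ⊗ x^ (3 ^ t * u * 24)) ≡ c₂ W ℤ.+ + (3 ^ t) ℤ.* (+ 9 ℤ.* (+ u ℤ.* c₂ (W ⊗ β) ℤ.+ + 9 ℤ.* e)) →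
      + narayana n ≡ + (3 ^ t) ℤ.* (+ 9 ℤ.* (+ u ℤ.* (+ (3 ^ s) ℤ.* c) ℤ.+ + 9 ℤ.* e))
    narayana≡ {e} c₂≡ = begin
      + narayana n                     ≡⟨ c₂-x^ n ⟨
      c₂ (x^ suc n)                    ≡⟨ cong c₂ x^[1+n]≡ ⟩
      c₂ (W ⊗ x^ m)                    ≡⟨ cong (λ k → c₂ (W ⊗ x^ k)) m≡3ᵗ*u*24 ⟩
      c₂ (W ⊗ x^ (3 ^ t * u * 24))     ≡⟨ c₂≡ ⟩
      c₂ W ℤ.+ + (3 ^ t) ℤ.* (+ 9 ℤ.* (+ u ℤ.* c₂ (W ⊗ β) ℤ.+ + 9 ℤ.* e))
        ≡⟨ cong₂ (λ w q → w ℤ.+ + (3 ^ t) ℤ.* (+ 9 ℤ.* (+ u ℤ.* q ℤ.+ + 9 ℤ.* e))) c₂W≡0 c₂[W⊗β]≡ ⟩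
      + 0 ℤ.+ + (3 ^ t) ℤ.* (+ 9 ℤ.* (+ u ℤ.* (+ (3 ^ s) ℤ.* c) ℤ.+ + 9 ℤ.* e))
        ≡⟨ ℤ.+-identityˡ _ ⟩
      + (3 ^ t) ℤ.* (+ 9 ℤ.* (+ u ℤ.* (+ (3 ^ s) ℤ.* c) ℤ.+ + 9 ℤ.* e)) ∎

Residue₀ Residue₁ : ℕ → Set
Residue₀ r = r ≡ 1 ⊎ r ≡ 2 ⊎ r ≡ 3 ⊎ r ≡ 4 ⊎ r ≡ 6
Residue₁ r = r ≡ 5 ⊎ r ≡ 7 ⊎ r ≡ 13 ⊎ r ≡ 15

isValuation-narayana-Residue₀-<24 : ∀ {r} → r < 24 → Residue₀ (r % 8) → IsValuation 3 (narayana r) 0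
isValuation-narayana-Residue₀-<24 =
  from-yes (allUpTo? (λ r → residue₀? (r % 8) →-dec isValuation? 3 (narayana r) 0) 24)
  where
  residue₀? : ∀ r → Dec (Residue₀ r)
  residue₀? r = r ≟ 1 ⊎-dec r ≟ 2 ⊎-dec r ≟ 3 ⊎-dec r ≟ 4 ⊎-dec r ≟ 6

isValuation-narayana-Residue₁-<24 : ∀ {r} → r < 24 → Residue₁ r → IsValuation 3 (narayana r) 1
isValuation-narayana-Residue₁-<24 =
  from-yes (allUpTo? (λ r → residue₁? r →-dec isValuation? 3 (narayana r) 1) 24)
  where
  residue₁? : ∀ r → Dec (Residue₁ r)
  residue₁? r = r ≟ 5 ⊎-dec r ≟ 7 ⊎-dec r ≟ 13 ⊎-dec r ≟ 15

at-residue : (P : ℕ → Set) → ∀ n {r} → n % 24 ≡ r → (∀ K → P (r + K * 24)) → P n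
at-residue P n refl P[r+K*24] = subst P (sym (m≡m%n+[m/n]*n n 24)) (P[r+K*24] (n / 24))

isValuation-narayana-Residue₀ : ∀ n → Residue₀ (n % 8) → IsValuation 3 (narayana n) 0
isValuation-narayana-Residue₀ n n%8∈ = at-residue (λ m → IsValuation 3 (narayana m) 0) n refl λ K →
  isValuation-narayana-periodic (n % 24) K z≤n
    (isValuation-narayana-Residue₀-<24 (m%n<n n 24) (subst Residue₀ (sym n%24%8≡n%8) n%8∈))
  where
  n%24%8≡n%8 : n % 24 % 8 ≡ n % 8
  n%24%8≡n%8 = m∣n⇒o%n%m≡o%m 8 24 n (divides 3 refl)

isValuation-narayana-Residue₁ : ∀ n → Residue₁ (n % 24) → IsValuation 3 (narayana n) 1
isValuation-narayana-Residue₁ n n%24∈ = at-residue (λ m → IsValuation 3 (narayana m) 1) n refl λ K →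
  isValuation-narayana-periodic (n % 24) K (s≤s z≤n) (isValuation-narayana-Residue₁-<24 (m%n<n n 24) n%24∈)

isValuation-narayana-8 : ∀ n → n % 24 ≡ 8 → IsValuation 3 (narayana n) 2
isValuation-narayana-8 n n%24≡8 =
  at-residue (λ m → IsValuation 3 (narayana m) 2) n n%24≡8 isValuation-narayana[8+K*24]

isValuation-narayana-23 : ∀ n → n % 24 ≡ 23 →
  ∃ λ k → IsValuation 3 (n + 1) k × IsValuation 3 (narayana n) (k + 1)
isValuation-narayana-23 n n%24≡23 =
  at-residue (λ m → ∃ λ k → IsValuation 3 (m + 1) k × IsValuation 3 (narayana m) (k + 1)) n n%24≡23 λ K →
    isValuation-narayana-near-24M (23 + K * 24) K 𝟙 (+ 305) (+-comm (23 + K * 24) 1)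
      (x^-shift 𝟙 0 (23 + K * 24) (cong (𝟙 ⊗_) x^-zero)) refl refl z≤n (from-no (3 ∣? 305))

isValuation-narayana-21 : ∀ n → n % 24 ≡ 21 →
  ∃ λ k → IsValuation 3 (n + 3) k × IsValuation 3 (narayana n) (k + 1)
isValuation-narayana-21 n n%24≡21 =
  at-residue (λ m → ∃ λ k → IsValuation 3 (m + 3) k × IsValuation 3 (narayana m) (k + 1)) n n%24≡21 λ K →
    isValuation-narayana-near-24M (21 + K * 24) K x⁻² (+ 142) (+-comm (21 + K * 24) 3)
      (x^-shift x⁻² 2 (21 + K * 24) (cong (x⁻² ⊗_) x^2)) refl refl z≤n (from-no (3 ∣? 142))
  where
  x⁻² : Cubic ℤ
  x⁻² = ⟨ ℤ.-1ℤ , + 1 , + 0 ⟩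

isValuation-narayana-0 : ∀ n → n ≥ 1 → n % 24 ≡ 0 →
  ∃ λ k → IsValuation 3 n k × IsValuation 3 (narayana n) (k + 2)
isValuation-narayana-0 n n≥1 n%24≡0 =
  at-residue (λ m → m ≥ 1 → ∃ λ k → IsValuation 3 m k × IsValuation 3 (narayana m) (k + 2)) n n%24≡0
    (λ { zero ()
       ; (suc K) _ → isValuation-narayana-near-24M (suc K * 24) K x (+ 149) refl
                       (x^-suc (suc K * 24)) refl refl (s≤s z≤n) (from-no (3 ∣? 149)) })
    n≥1

isValuation-narayana-16 : ∀ n → n % 24 ≡ 16 →
  ∃ λ k → IsValuation 3 (n + 8) k × IsValuation 3 (narayana n) (k + 2)
isValuation-narayana-16 n n%24≡16 =
  at-residue (λ m → ∃ λ k → IsValuation 3 (m + 8) k × IsValuation 3 (narayana m) (k + 2)) n n%24≡16 λ K →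
    isValuation-narayana-near-24M (16 + K * 24) K x⁻⁷ (+ 7) (+-comm (16 + K * 24) 8)
      (x^-shift x⁻⁷ 7 (16 + K * 24) (cong (x⁻⁷ ⊗_) (x^[3+n] 4))) refl refl (s≤s z≤n) (from-no (3 ∣? 7))
  where
  x⁻⁷ : Cubic ℤ
  x⁻⁷ = ⟨ + 3 , ℤ.- + 2 , + 0 ⟩

theorem1 : (n : ℕ) → n ≥ 1 →
    ((n % 8 ≡ 1 ⊎ n % 8 ≡ 2 ⊎ n % 8 ≡ 3 ⊎ n % 8 ≡ 4 ⊎ n % 8 ≡ 6) →
      IsValuation 3 (narayana n) 0)
    × ((n % 24 ≡ 5 ⊎ n % 24 ≡ 7 ⊎ n % 24 ≡ 13 ⊎ n % 24 ≡ 15) →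
      IsValuation 3 (narayana n) 1)
    × (n % 24 ≡ 8 → IsValuation 3 (narayana n) 2)
    × (n % 24 ≡ 23 → ∃ λ k → IsValuation 3 (n + 1) k × IsValuation 3 (narayana n) (k + 1))
    × (n % 24 ≡ 21 → ∃ λ k → IsValuation 3 (n + 3) k × IsValuation 3 (narayana n) (k + 1))
    × (n % 24 ≡ 0 → ∃ λ k → IsValuation 3 n k × IsValuation 3 (narayana n) (k + 2))
    × (n % 24 ≡ 16 → ∃ λ k → IsValuation 3 (n + 8) k × IsValuation 3 (narayana n) (k + 2))
theorem1 n n≥1 =
    isValuation-narayana-Residue₀ n
  , isValuation-narayana-Residue₁ n
  , isValuation-narayana-8 n
  , isValuation-narayana-23 n
  , isValuation-narayana-21 n
  , isValuation-narayana-0 n n≥1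
  , isValuation-narayana-16 n
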